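{- Let $k\ge 3$, and for $n\ge 0$ let $P^{(k)}(n)$ be the number of pairs $(s,t)$ with $1\le s<t\le|W^{(k)}_n|$ such that $W^{(k)}_n[s,t]$ is a palindrome. Then $P^{(k)}(1)=0$ and, for every $2\le n\le k-1$, $P^{(k)}(n)=2P^{(k)}(n-1)+2^{n-1}-1$.
   Context: The alphabet is $\mathbb{N}=\{0,1,2,\dots\}$. For an integer $k\ge 3$, $\varphi_k$ is the morphism of $\mathbb{N}^*$ defined on letters, for $i\ge 0$ and $0\le j\le k-1$, by $\varphi_k(ki+j)=(ki)(ki+j+1)$ (two letters) if $0\le j\le k-2$, and $\varphi_k(ki+k-1)=(ki+k)$ (one letter). For $n\ge 0$, $W^{(k)}_n=\varphi_k^n(0)$. For $W=w_1\cdots w_m$, $W[s,t]=w_s\cdots w_t$. A palindrome is a word equal to its reversal. -}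

module Defs where

open import Data.Nat using (ℕ; zero; suc; _+_; _*_; _∸_; _<_; _<?_; NonZero)
open import Data.Nat.DivMod using (_%_)
open import Data.List using (List; []; _∷_; concatMap; length; take; drop; reverse; upTo; map; sum; filter; applyUpTo)
open import Data.List.Properties using (≡-dec)
open import Data.Nat.Properties using (_≟_)
open import Data.Product using (_×_; _,_)
open import Relation.Nullary using (Dec; yes; no)
open import Relation.Binary.PropositionalEquality using (_≡_)

-- The morphism φ_k on a single letter a = k*i + j (j = a % k, 0 ≤ j ≤ k-1):
--   φ_k(ki+j) = (ki)(ki+j+1)  if j ≤ k-2
--   φ_k(ki+k-1) = (ki+k) = a+1
φ-letter : (k : ℕ) → .{{NonZero k}} → ℕ → List ℕ
φ-letter k a with suc (a % k) <? k
... | yes _ = (a ∸ (a % k)) ∷ suc a ∷ []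
... | no  _ = suc a ∷ []

φ : (k : ℕ) → .{{NonZero k}} → List ℕ → List ℕ
φ k w = concatMap (φ-letter k) w

φ^ : (k : ℕ) → .{{NonZero k}} → ℕ → List ℕ → List ℕ
φ^ k zero    w = w
φ^ k (suc n) w = φ k (φ^ k n w)

W : (k : ℕ) → .{{NonZero k}} → ℕ → List ℕ
W k n = φ^ k n (0 ∷ [])

-- W[s,t] = w_s ⋯ w_t (1-indexed, inclusive)
factor : List ℕ → ℕ → ℕ → List ℕ
factor w s t = take (suc t ∸ s) (drop (s ∸ 1) w)

IsPalindrome : List ℕ → Set
IsPalindrome u = reverse u ≡ u

isPalindrome? : (u : List ℕ) → Dec (IsPalindrome u)
isPalindrome? u = ≡-dec _≟_ (reverse u) u

pairs : ℕ → List (ℕ × ℕ)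
pairs m = concatMap (λ t → map (λ s → (s , t)) (applyUpTo suc (t ∸ 1))) (applyUpTo suc m)

palCount : List ℕ → ℕ
palCount w = length (filter (λ p → isPalindrome? (factor w (Data.Product.proj₁ p) (Data.Product.proj₂ p))) (pairs (length w)))

P : (k : ℕ) → .{{NonZero k}} → ℕ → ℕ
P k n = palCount (W k n)

-- For n < k the letter n first occurs at the very end of W_n: W_n = Z_n n, where
-- Z_0 is empty and Z_{m+1} = Z_m m Z_m is the Zimin word, which avoids the letter m.
-- A palindrome of length ≥ 2 containing a letter that occurs only once in the word must
-- be centred at it. Hence no palindromic factor ends at the final letter of W_n, and in
-- Z_m m Z_m the palindromes through m are exactly x m y with x = reverse y; since Z_m is
-- a palindrome there is exactly one of them ending at each position of the right copy
-- of Z_m. So P(n) = 2 P(n-1) + |Z_{n-1}|, and |Z_m| = 2^m - 1.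
module Submission where

open import Data.Empty using (⊥-elim)
open import Data.List using (List; []; _∷_; _++_; length; take; drop; reverse; map; filter; applyUpTo; concatMap)
open import Data.List.Properties
  using (≡-dec; ∷-injectiveˡ; ∷-injectiveʳ; ++-assoc; length-++; length-reverse; reverse-++; unfold-reverse
        ; reverse-involutive; take++drop≡id; take-drop; map-++; map-∘)
open import Data.List.Relation.Unary.All using (All; []; _∷_)
import Data.List.Relation.Unary.All as All
open import Data.List.Relation.Unary.All.Properties using (++⁺; take⁺)
open import Data.Nat using (ℕ; zero; suc; _+_; _*_; _∸_; _^_; _≤_; _<_; _<?_; NonZero; z≤n; s≤s)
open import Data.Nat.DivMod using (_%_; m<n⇒m%n≡m)
open import Data.Nat.ListAction using (sum)
open import Data.Nat.ListAction.Properties using (sum-++)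
open import Data.Nat.Properties
open import Data.Nat.Tactic.RingSolver using (solve-∀)
open import Algebra.Properties.CommutativeSemigroup +-commutativeSemigroup using (x∙yz≈y∙xz)
open import Data.Product using (_×_; _,_)
open import Function using (_∘_)
open import Relation.Binary.PropositionalEquality
open import Relation.Nullary using (Dec; yes; no; ¬_)

open import Defs

∑< : ℕ → (ℕ → ℕ) → ℕ
∑< zero    f = 0
∑< (suc m) f = f 0 + ∑< m (f ∘ suc)

syntax ∑< m (λ i → e) = ∑[ i < m ] e

∑-cong : ∀ m {f g : ℕ → ℕ} → (∀ i → i < m → f i ≡ g i) → ∑< m f ≡ ∑< m g
∑-cong zero    f≡g = refl
∑-cong (suc m) f≡g = cong₂ _+_ (f≡g 0 (s≤s z≤n)) (∑-cong m (λ i i<m → f≡g (suc i) (s≤s i<m)))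

∑-split : ∀ a b (f : ℕ → ℕ) → ∑< (a + b) f ≡ ∑< a f + ∑[ i < b ] f (a + i)
∑-split zero    b f = refl
∑-split (suc a) b f = trans (cong (f 0 +_) (∑-split a b (f ∘ suc))) (sym (+-assoc (f 0) _ _))

∑-1+ : ∀ m (f : ℕ → ℕ) → ∑[ i < m ] (1 + f i) ≡ m + ∑< m f
∑-1+ zero    f = refl
∑-1+ (suc m) f = cong suc (trans (cong (f 0 +_) (∑-1+ m (f ∘ suc))) (x∙yz≈y∙xz (f 0) m _))

sum-map-applyUpTo : ∀ {A : Set} (g : A → ℕ) (f : ℕ → A) m →
  sum (map g (applyUpTo f m)) ≡ ∑[ i < m ] g (f i)
sum-map-applyUpTo g f zero    = refl
sum-map-applyUpTo g f (suc m) = cong (g (f 0) +_) (sum-map-applyUpTo g (f ∘ suc) m)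

sum-map-concatMap : ∀ {A B : Set} (g : B → ℕ) (h : A → List B) xs →
  sum (map g (concatMap h xs)) ≡ sum (map (sum ∘ map g ∘ h) xs)
sum-map-concatMap g h []       = refl
sum-map-concatMap g h (x ∷ xs) = begin
  sum (map g (h x ++ concatMap h xs))               ≡⟨ cong sum (map-++ g (h x) _) ⟩
  sum (map g (h x) ++ map g (concatMap h xs))       ≡⟨ sum-++ (map g (h x)) _ ⟩
  sum (map g (h x)) + sum (map g (concatMap h xs))  ≡⟨ cong (sum (map g (h x)) +_) (sum-map-concatMap g h xs) ⟩
  sum (map g (h x)) + sum (map (sum ∘ map g ∘ h) xs) ∎
  where open ≡-Reasoning

indicator : ∀ {a} {A : Set a} → Dec A → ℕ
indicator (yes _) = 1
indicator (no _)  = 0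

indicator-cong : ∀ {a b} {A : Set a} {B : Set b} (A? : Dec A) (B? : Dec B) →
  (A → B) → (B → A) → indicator A? ≡ indicator B?
indicator-cong (yes _) (yes _) _ _ = refl
indicator-cong (yes a) (no ¬b) f _ = ⊥-elim (¬b (f a))
indicator-cong (no ¬a) (yes b) _ g = ⊥-elim (¬a (g b))
indicator-cong (no _)  (no _)  _ _ = refl

indicator-yes : ∀ {a} {A : Set a} (A? : Dec A) → A → indicator A? ≡ 1
indicator-yes (yes _) _ = refl
indicator-yes (no ¬a) a = ⊥-elim (¬a a)

indicator-no : ∀ {a} {A : Set a} (A? : Dec A) → ¬ A → indicator A? ≡ 0
indicator-no (yes a) ¬a = ⊥-elim (¬a a)
indicator-no (no _)  _  = refl

length-filter≡sum-indicator : ∀ {A : Set} {P : A → Set} (P? : ∀ x → Dec (P x)) xs →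
  length (filter P? xs) ≡ sum (map (indicator ∘ P?) xs)
length-filter≡sum-indicator P? []       = refl
length-filter≡sum-indicator P? (x ∷ xs) with P? x
... | yes _ = cong suc (length-filter≡sum-indicator P? xs)
... | no  _ = length-filter≡sum-indicator P? xs

take-++ˡ : ∀ {A : Set} n (xs ys : List A) → n ≤ length xs → take n (xs ++ ys) ≡ take n xs
take-++ˡ zero    xs       ys _         = refl
take-++ˡ (suc n) (x ∷ xs) ys (s≤s n≤) = cong (x ∷_) (take-++ˡ n xs ys n≤)

take-++ʳ : ∀ {A : Set} (xs : List A) n ys → take (length xs + n) (xs ++ ys) ≡ xs ++ take n ys
take-++ʳ []       n ys = refl
take-++ʳ (x ∷ xs) n ys = cong (x ∷_) (take-++ʳ xs n ys)

length-take-≤ : ∀ {A : Set} n (xs : List A) → n ≤ length xs → length (take n xs) ≡ n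
length-take-≤ zero    xs       _         = refl
length-take-≤ (suc n) (x ∷ xs) (s≤s n≤) = cong suc (length-take-≤ n xs n≤)

reverse-++-∷ : ∀ {A : Set} (x : List A) c y → reverse (x ++ c ∷ y) ≡ reverse y ++ c ∷ reverse x
reverse-++-∷ x c y = begin
  reverse (x ++ c ∷ y)               ≡⟨ reverse-++ x (c ∷ y) ⟩
  reverse (c ∷ y) ++ reverse x       ≡⟨ cong (_++ reverse x) (unfold-reverse c y) ⟩
  (reverse y ++ c ∷ []) ++ reverse x ≡⟨ ++-assoc (reverse y) (c ∷ []) (reverse x) ⟩
  reverse y ++ c ∷ reverse x         ∎
  where open ≡-Reasoning

All-reverse : ∀ {A : Set} {P : A → Set} (xs : List A) → All P xs → All P (reverse xs)
All-reverse []       []         = []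
All-reverse (x ∷ xs) (px ∷ pxs) =
  subst (All _) (sym (unfold-reverse x xs)) (++⁺ (All-reverse xs pxs) (px ∷ []))

prefix-before-fresh-letter : ∀ {c} (x x′ y y′ : List ℕ) → All (c ≢_) x → All (c ≢_) x′ →
  x ++ c ∷ y ≡ x′ ++ c ∷ y′ → x ≡ x′
prefix-before-fresh-letter []      []        _ _ _         _          _  = refl
prefix-before-fresh-letter []      (_ ∷ _)   _ _ _         (c≢a′ ∷ _) eq = ⊥-elim (c≢a′ (∷-injectiveˡ eq))
prefix-before-fresh-letter (_ ∷ _) []        _ _ (c≢a ∷ _) _          eq = ⊥-elim (c≢a (sym (∷-injectiveˡ eq)))
prefix-before-fresh-letter (a ∷ x) (a′ ∷ x′) y y′ (_ ∷ fx)  (_ ∷ fx′)  eq =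
  cong₂ _∷_ (∷-injectiveˡ eq) (prefix-before-fresh-letter x x′ y y′ fx fx′ (∷-injectiveʳ eq))

infix 4 _≟ₗ_
_≟ₗ_ : (u v : List ℕ) → Dec (u ≡ v)
_≟ₗ_ = ≡-dec _≟_

pal : List ℕ → ℕ
pal u = indicator (isPalindrome? u)

palindrome-around-fresh-letter : ∀ c x y → All (c ≢_) x → All (c ≢_) y →
  pal (x ++ c ∷ y) ≡ indicator (x ≟ₗ reverse y)
palindrome-around-fresh-letter c x y fx fy = indicator-cong _ _ mirrored palindrome
  where
  mirrored : reverse (x ++ c ∷ y) ≡ x ++ c ∷ y → x ≡ reverse y
  mirrored eq = sym (prefix-before-fresh-letter (reverse y) x (reverse x) y (All-reverse y fy) fx
                       (trans (sym (reverse-++-∷ x c y)) eq))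
  palindrome : x ≡ reverse y → reverse (x ++ c ∷ y) ≡ x ++ c ∷ y
  palindrome refl =
    trans (reverse-++-∷ (reverse y) c y) (cong (λ z → reverse y ++ c ∷ z) (reverse-involutive y))

-- Defs counts pairs s < t, that is, palindromic factors of length at least 2.
longPal : List ℕ → ℕ
longPal []            = 0
longPal (_ ∷ [])      = 0
longPal u@(_ ∷ _ ∷ _) = pal u

palSuffixes : List ℕ → ℕ
palSuffixes []      = 0
palSuffixes (a ∷ v) = longPal (a ∷ v) + palSuffixes v

palFactors : List ℕ → ℕ
palFactors w = ∑[ t < length w ] palSuffixes (take (suc t) w)

palSuffixes≡∑ : ∀ v → palSuffixes v ≡ ∑[ i < length v ∸ 1 ] pal (drop i v)
palSuffixes≡∑ []          = refl
palSuffixes≡∑ (_ ∷ [])    = refl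
palSuffixes≡∑ (a ∷ b ∷ v) = cong (pal (a ∷ b ∷ v) +_) (palSuffixes≡∑ (b ∷ v))

factor-suc : ∀ w s t → s ≤ t → factor w (suc s) (suc t) ≡ drop s (take (suc t) w)
factor-suc w s t s≤t =
  trans (take-drop (suc t ∸ s) s w) (cong (λ n → drop s (take n w)) (m+[n∸m]≡n (m≤n⇒m≤1+n s≤t)))

palSuffixes-take : ∀ w t → t < length w →
  ∑[ s < t ] pal (factor w (suc s) (suc t)) ≡ palSuffixes (take (suc t) w)
palSuffixes-take w t t<∣w∣ = begin
  ∑[ s < t ] pal (factor w (suc s) (suc t))
    ≡⟨ ∑-cong t (λ s s<t → cong pal (factor-suc w s t (<⇒≤ s<t))) ⟩
  ∑[ s < t ] pal (drop s (take (suc t) w))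
    ≡⟨ cong (λ n → ∑[ s < n ∸ 1 ] pal (drop s (take (suc t) w))) (length-take-≤ (suc t) w t<∣w∣) ⟨
  ∑[ s < length (take (suc t) w) ∸ 1 ] pal (drop s (take (suc t) w))
    ≡⟨ palSuffixes≡∑ (take (suc t) w) ⟨
  palSuffixes (take (suc t) w) ∎
  where open ≡-Reasoning

palCount≡palFactors : ∀ w → palCount w ≡ palFactors w
palCount≡palFactors w =
  trans (length-filter≡sum-indicator _ (pairs (length w)))
  (trans (sum-map-concatMap _ _ (applyUpTo suc (length w)))
  (trans (sum-map-applyUpTo _ suc (length w))
  (∑-cong (length w) λ t t<∣w∣ →
    trans (cong sum (sym (map-∘ (applyUpTo suc t))))
    (trans (sum-map-applyUpTo _ suc t) (palSuffixes-take w t t<∣w∣)))))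

palFactors-++ : ∀ xs ys →
  palFactors (xs ++ ys) ≡ palFactors xs + ∑[ j < length ys ] palSuffixes (xs ++ take (suc j) ys)
palFactors-++ xs ys = begin
  ∑[ t < length (xs ++ ys) ] palSuffixes (take (suc t) (xs ++ ys))
    ≡⟨ cong (λ n → ∑[ t < n ] palSuffixes (take (suc t) (xs ++ ys))) (length-++ xs) ⟩
  ∑[ t < length xs + length ys ] palSuffixes (take (suc t) (xs ++ ys))
    ≡⟨ ∑-split (length xs) (length ys) _ ⟩
  ∑[ t < length xs ] palSuffixes (take (suc t) (xs ++ ys))
    + ∑[ j < length ys ] palSuffixes (take (suc (length xs + j)) (xs ++ ys))
    ≡⟨ cong₂ _+_ (∑-cong (length xs) λ t t<∣xs∣ → cong palSuffixes (take-++ˡ (suc t) xs ys t<∣xs∣))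
                 (∑-cong (length ys) λ j _ → cong palSuffixes (right-part j)) ⟩
  palFactors xs + ∑[ j < length ys ] palSuffixes (xs ++ take (suc j) ys) ∎
  where
  open ≡-Reasoning
  right-part : ∀ j → take (suc (length xs + j)) (xs ++ ys) ≡ xs ++ take (suc j) ys
  right-part j =
    trans (cong (λ n → take n (xs ++ ys)) (sym (+-suc (length xs) j))) (take-++ʳ xs (suc j) ys)

crossingPalSuffixes : List ℕ → List ℕ → ℕ
crossingPalSuffixes []      z = 0
crossingPalSuffixes (a ∷ x) z = longPal (a ∷ x ++ z) + crossingPalSuffixes x z

palSuffixes-++ : ∀ x z → palSuffixes (x ++ z) ≡ crossingPalSuffixes x z + palSuffixes z
palSuffixes-++ []      z = refl
palSuffixes-++ (a ∷ x) z =
  trans (cong (longPal (a ∷ x ++ z) +_) (palSuffixes-++ x z)) (sym (+-assoc (longPal (a ∷ x ++ z)) _ _))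

suffixCount : List ℕ → List ℕ → ℕ
suffixCount []      v = 0
suffixCount (a ∷ x) v = indicator (a ∷ x ≟ₗ v) + suffixCount x v

suffixCount-[] : ∀ x → suffixCount x [] ≡ 0
suffixCount-[] []      = refl
suffixCount-[] (a ∷ x) = suffixCount-[] x

suffixCount-shorter : ∀ x v → length x < length v → suffixCount x v ≡ 0
suffixCount-shorter []      v _        = refl
suffixCount-shorter (a ∷ x) v ∣x∣<∣v∣ =
  cong₂ _+_ (indicator-no (a ∷ x ≟ₗ v) (λ eq → <-irrefl (cong length eq) ∣x∣<∣v∣))
            (suffixCount-shorter x v (<-trans (n<1+n _) ∣x∣<∣v∣))

suffixCount-++ : ∀ p v → 0 < length v → suffixCount (p ++ v) v ≡ 1
suffixCount-++ []      (a ∷ v) _ =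
  cong₂ _+_ (indicator-yes (a ∷ v ≟ₗ a ∷ v) refl) (suffixCount-shorter v (a ∷ v) (n<1+n _))
suffixCount-++ (b ∷ p) v 0<∣v∣ =
  cong₂ _+_ (indicator-no (b ∷ p ++ v ≟ₗ v) longer) (suffixCount-++ p v 0<∣v∣)
  where
  longer : b ∷ p ++ v ≢ v
  longer eq = <-irrefl (sym (cong length eq))
                       (s≤s (≤-trans (m≤n+m (length v) (length p)) (≤-reflexive (sym (length-++ p)))))

crossingPalSuffixes-fresh : ∀ c x y → All (c ≢_) x → All (c ≢_) y →
  crossingPalSuffixes x (c ∷ y) ≡ suffixCount x (reverse y)
crossingPalSuffixes-fresh c []      y _          _  = refl
crossingPalSuffixes-fresh c (a ∷ x) y (c≢a ∷ fx) fy =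
  cong₂ _+_ (trans (longPal≡pal x) (palindrome-around-fresh-letter c (a ∷ x) y (c≢a ∷ fx) fy))
            (crossingPalSuffixes-fresh c x y fx fy)
  where
  longPal≡pal : ∀ x → longPal (a ∷ x ++ c ∷ y) ≡ pal (a ∷ x ++ c ∷ y)
  longPal≡pal []      = refl
  longPal≡pal (_ ∷ _) = refl

longPal-fresh-head : ∀ c y → All (c ≢_) y → longPal (c ∷ y) ≡ 0
longPal-fresh-head c []      _  = refl
longPal-fresh-head c (b ∷ y) fy =
  trans (palindrome-around-fresh-letter c [] (b ∷ y) [] fy)
        (indicator-no ([] ≟ₗ reverse (b ∷ y)) (λ eq → 0≢1+n (trans (cong length eq) (length-reverse (b ∷ y)))))

palSuffixes-around-fresh-letter : ∀ c x y → All (c ≢_) x → All (c ≢_) y →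
  palSuffixes (x ++ c ∷ y) ≡ suffixCount x (reverse y) + palSuffixes y
palSuffixes-around-fresh-letter c x y fx fy =
  trans (palSuffixes-++ x (c ∷ y))
        (cong₂ _+_ (crossingPalSuffixes-fresh c x y fx fy) (cong (_+ palSuffixes y) (longPal-fresh-head c y fy)))

palSuffixes-fresh-last : ∀ c L → All (c ≢_) L → palSuffixes (L ++ c ∷ []) ≡ 0
palSuffixes-fresh-last c L fL =
  trans (palSuffixes-around-fresh-letter c L [] fL []) (cong (_+ 0) (suffixCount-[] L))

palFactors-fresh-last : ∀ c L → All (c ≢_) L → palFactors (L ++ c ∷ []) ≡ palFactors L
palFactors-fresh-last c L fL =
  trans (palFactors-++ L (c ∷ []))
        (trans (cong (λ n → palFactors L + (n + 0)) (palSuffixes-fresh-last c L fL)) (+-identityʳ _))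

suffixCount-reverse-prefix : ∀ L m → reverse L ≡ L → 0 < m → m ≤ length L →
  suffixCount L (reverse (take m L)) ≡ 1
suffixCount-reverse-prefix L m rL 0<m m≤∣L∣ =
  trans (cong (λ z → suffixCount z (reverse (take m L))) L≡suffix)
        (suffixCount-++ (reverse (drop m L)) (reverse (take m L))
           (subst (0 <_) (sym (trans (length-reverse (take m L)) (length-take-≤ m L m≤∣L∣))) 0<m))
  where
  L≡suffix : L ≡ reverse (drop m L) ++ reverse (take m L)
  L≡suffix = begin
    L                                          ≡⟨ rL ⟨
    reverse L                                  ≡⟨ cong reverse (take++drop≡id m L) ⟨
    reverse (take m L ++ drop m L)             ≡⟨ reverse-++ (take m L) (drop m L) ⟩
    reverse (drop m L) ++ reverse (take m L)   ∎
    where open ≡-Reasoning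

palFactors-mirror : ∀ c L → All (c ≢_) L → reverse L ≡ L →
  palFactors (L ++ c ∷ L) ≡ palFactors L + (length L + palFactors L)
palFactors-mirror c L fL rL = begin
  palFactors (L ++ c ∷ L)
    ≡⟨ palFactors-++ L (c ∷ L) ⟩
  palFactors L + (palSuffixes (L ++ c ∷ []) + right)
    ≡⟨ cong (λ n → palFactors L + (n + right)) (palSuffixes-fresh-last c L fL) ⟩
  palFactors L + right
    ≡⟨ cong (palFactors L +_) (∑-cong (length L) centred-at-c) ⟩
  palFactors L + ∑[ j < length L ] (1 + palSuffixes (take (suc j) L))
    ≡⟨ cong (palFactors L +_) (∑-1+ (length L) _) ⟩
  palFactors L + (length L + palFactors L) ∎
  where
  open ≡-Reasoning
  right : ℕ
  right = ∑[ j < length L ] palSuffixes (L ++ c ∷ take (suc j) L)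
  centred-at-c : ∀ j → j < length L → palSuffixes (L ++ c ∷ take (suc j) L) ≡ 1 + palSuffixes (take (suc j) L)
  centred-at-c j j<∣L∣ =
    trans (palSuffixes-around-fresh-letter c L (take (suc j) L) fL (take⁺ (suc j) fL))
          (cong (_+ palSuffixes (take (suc j) L)) (suffixCount-reverse-prefix L (suc j) rL (s≤s z≤n) j<∣L∣))

zimin : ℕ → List ℕ
zimin zero    = []
zimin (suc n) = zimin n ++ n ∷ zimin n

zimin-palindrome : ∀ n → reverse (zimin n) ≡ zimin n
zimin-palindrome zero    = refl
zimin-palindrome (suc n) =
  trans (reverse-++-∷ (zimin n) n (zimin n)) (cong₂ (λ a b → a ++ n ∷ b) (zimin-palindrome n) (zimin-palindrome n))

zimin-< : ∀ n → All (_< n) (zimin n)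
zimin-< zero    = []
zimin-< (suc n) = ++⁺ below (n<1+n n ∷ below)
  where below = All.map (λ i<n → <-trans i<n (n<1+n n)) (zimin-< n)

zimin-fresh : ∀ n → All (n ≢_) (zimin n)
zimin-fresh n = All.map (λ i<n n≡i → <-irrefl (sym n≡i) i<n) (zimin-< n)

suc-length-zimin : ∀ n → suc (length (zimin n)) ≡ 2 ^ n
suc-length-zimin zero    = refl
suc-length-zimin (suc n) =
  trans (cong suc (length-++ (zimin n)))
        (trans (doubling (length (zimin n))) (cong (λ x → x + (x + 0)) (suc-length-zimin n)))
  where
  doubling : ∀ a → suc (a + suc a) ≡ suc a + (suc a + 0)
  doubling = solve-∀

palFactors-zimin-suc : ∀ m → palFactors (zimin (suc m)) ≡ 2 * palFactors (zimin m) + 2 ^ m ∸ 1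
palFactors-zimin-suc m = begin
  palFactors (zimin (suc m)) ≡⟨ palFactors-mirror m (zimin m) (zimin-fresh m) (zimin-palindrome m) ⟩
  g + (ℓ + g)                ≡⟨ cong (_∸ 1) (rearrange g ℓ) ⟨
  2 * g + suc ℓ ∸ 1          ≡⟨ cong (λ n → 2 * g + n ∸ 1) (suc-length-zimin m) ⟩
  2 * g + 2 ^ m ∸ 1          ∎
  where
  open ≡-Reasoning
  g ℓ : ℕ
  g = palFactors (zimin m)
  ℓ = length (zimin m)
  rearrange : ∀ g ℓ → 2 * g + suc ℓ ≡ suc (g + (ℓ + g))
  rearrange = solve-∀

module _ (k : ℕ) .{{_ : NonZero k}} where

  φ-++ : ∀ u v → φ k (u ++ v) ≡ φ k u ++ φ k v
  φ-++ []      v = refl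
  φ-++ (a ∷ u) v =
    trans (cong (φ-letter k a ++_) (φ-++ u v)) (sym (++-assoc (φ-letter k a) (φ k u) (φ k v)))

  φ^-++ : ∀ n u v → φ^ k n (u ++ v) ≡ φ^ k n u ++ φ^ k n v
  φ^-++ zero    u v = refl
  φ^-++ (suc n) u v = trans (cong (φ k) (φ^-++ n u v)) (φ-++ (φ^ k n u) (φ^ k n v))

  φ^-suc : ∀ n w → φ^ k (suc n) w ≡ φ^ k n (φ k w)
  φ^-suc zero    w = refl
  φ^-suc (suc n) w = cong (φ k) (φ^-suc n w)

  φ-letter-< : ∀ j → suc j < k → φ-letter k j ≡ 0 ∷ suc j ∷ []
  φ-letter-< j 1+j<k with suc (j % k) <? k | m<n⇒m%n≡m {k} {j} (<-trans (n<1+n j) 1+j<k)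
  ... | yes _      | j%k≡j rewrite j%k≡j = cong (_∷ suc j ∷ []) (n∸n≡0 j)
  ... | no  1+j≮k | j%k≡j = ⊥-elim (1+j≮k (subst (λ i → suc i < k) (sym j%k≡j) 1+j<k))

  φ^-letter : ∀ n j → n + j < k → φ^ k n (j ∷ []) ≡ zimin n ++ (n + j) ∷ []
  φ^-letter zero    j _     = refl
  φ^-letter (suc n) j n+1+j<k = begin
    φ^ k (suc n) (j ∷ [])
      ≡⟨ φ^-suc n (j ∷ []) ⟩
    φ^ k n (φ-letter k j ++ [])
      ≡⟨ cong (λ u → φ^ k n (u ++ [])) (φ-letter-< j 1+j<k) ⟩
    φ^ k n (0 ∷ [] ++ suc j ∷ [])
      ≡⟨ φ^-++ n (0 ∷ []) (suc j ∷ []) ⟩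
    φ^ k n (0 ∷ []) ++ φ^ k n (suc j ∷ [])
      ≡⟨ cong₂ _++_ (φ^-letter n 0 n+0<k) (φ^-letter n (suc j) n+1+j<k′) ⟩
    (zimin n ++ n + 0 ∷ []) ++ zimin n ++ n + suc j ∷ []
      ≡⟨ cong₂ (λ a b → (zimin n ++ a ∷ []) ++ zimin n ++ b ∷ []) (+-identityʳ n) (+-suc n j) ⟩
    (zimin n ++ n ∷ []) ++ zimin n ++ suc n + j ∷ []
      ≡⟨ ++-assoc (zimin n) (n ∷ []) _ ⟩
    zimin n ++ n ∷ zimin n ++ suc n + j ∷ []
      ≡⟨ ++-assoc (zimin n) (n ∷ zimin n) _ ⟨
    zimin (suc n) ++ suc n + j ∷ [] ∎
    where
    open ≡-Reasoning
    n+1+j<k′ : n + suc j < k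
    n+1+j<k′ = subst (_< k) (sym (+-suc n j)) n+1+j<k
    1+j<k : suc j < k
    1+j<k = ≤-<-trans (s≤s (m≤n+m j n)) n+1+j<k
    n+0<k : n + 0 < k
    n+0<k = ≤-<-trans (+-monoʳ-≤ n z≤n) n+1+j<k′

  W≡zimin∷ʳ : ∀ n → n < k → W k n ≡ zimin n ++ n ∷ []
  W≡zimin∷ʳ n n<k =
    trans (φ^-letter n 0 (subst (_< k) (sym (+-identityʳ n)) n<k)) (cong (λ i → zimin n ++ i ∷ []) (+-identityʳ n))

  P≡palFactors-zimin : ∀ n → n < k → P k n ≡ palFactors (zimin n)
  P≡palFactors-zimin n n<k =
    trans (palCount≡palFactors (W k n))
          (trans (cong palFactors (W≡zimin∷ʳ n n<k)) (palFactors-fresh-last n (zimin n) (zimin-fresh n)))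

lemma5p3 : (k : ℕ) → .{{_ : NonZero k}} → 3 ≤ k →
    (P k 1 ≡ 0) × (∀ n → 2 ≤ n → n ≤ k ∸ 1 → P k n ≡ 2 * P k (n ∸ 1) + 2 ^ (n ∸ 1) ∸ 1)
lemma5p3 k@(suc k′) 3≤k = P≡palFactors-zimin k 1 (<-≤-trans (s≤s (s≤s z≤n)) 3≤k) , recurrence
  where
  recurrence : ∀ n → 2 ≤ n → n ≤ k′ → P k n ≡ 2 * P k (n ∸ 1) + 2 ^ (n ∸ 1) ∸ 1
  recurrence (suc m) _ 1+m≤k′ = begin
    P k (suc m)                           ≡⟨ P≡palFactors-zimin k (suc m) (s≤s 1+m≤k′) ⟩
    palFactors (zimin (suc m))            ≡⟨ palFactors-zimin-suc m ⟩
    2 * palFactors (zimin m) + 2 ^ m ∸ 1  ≡⟨ cong (λ g → 2 * g + 2 ^ m ∸ 1) (P≡palFactors-zimin k m m<k) ⟨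
    2 * P k m + 2 ^ m ∸ 1                 ∎
    where
    open ≡-Reasoning
    m<k : m < k
    m<k = m≤n⇒m≤1+n 1+m≤k′
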